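{- Let $n\ge1$, $d\ge1$ and let $w$ be a word consisting of $n$ letters $U$, $n$ letters $D$ and $d$ letters $H$. Then $w\in\mathsf{Schr\ddot{o}der}_{n,d}$ if and only if $\mathsf{sts}_{n,d}(w)\in\mathsf{Sawtooth}_{n+1,d}$.
   Context: $\mathsf{Schr\ddot{o}der}_{n,d}$ is the set of words with $n$ $U$'s, $n$ $D$'s and $d$ $H$'s such that every prefix contains at most as many $D$'s as $U$'s. Steps: $\mathsf{s}=(0,-1)$, $\mathsf{w}=(-1,0)$, $\mathsf{n}=(0,1)$, $\mathsf{e}=(1,0)$, $\mathsf{nw}=(-1,1)$, $\mathsf{se}=(1,-1)$. For positive integers $N,d$, $\mathsf{Sawtooth}_{N,d}$ is the set of pairs of lattice paths (Upper, Lower) from $(0,0)$ to $(N,d)$ such that Upper uses steps in $\{\mathsf{n},\mathsf{se}\}$, Lower uses steps in $\{\mathsf{e},\mathsf{n}\}$, and the two paths meet only at $(0,0)$ and $(N,d)$ (paths are regarded as point sets, so their orientation is immaterial). For $w=w_1\cdots w_{2n+d}$, $\mathsf{sts}_{n,d}(w)=(\mathsf{Upper}(w),\mathsf{Lower}(w))$ is constructed as follows. Upper path: draw an $\mathsf{nw}$ step from $(n+1,d)$ to $(n,d+1)$; then read $w$ from left to right, drawing an $\mathsf{nw}$ step for each $U$ and an $\mathsf{s}$ step for each non-$U$ letter; finally draw one more $\mathsf{s}$ step, ending at $(0,0)$. Lower path: starting at $(n+1,d)$, read $w$ from left to right, drawing an $\mathsf{s}$ step for each $H$ and a $\mathsf{w}$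 step for each $D$ (and nothing for $U$); finally join the end point $(1,0)$ to $(0,0)$. -}

module Defs where

open import Data.Nat using (ℕ; zero; suc; _≤_)
open import Data.Integer using (ℤ; +_; _+_; _*_; -_)
open import Data.Product using (_×_; _,_; Σ-syntax; ∃-syntax)
open import Data.Sum using (_⊎_)
open import Data.List using (List; []; _∷_; _++_; [_]; map; concatMap; take)
open import Data.List.Relation.Unary.All using (All)
open import Data.List.Membership.Propositional using (_∈_)
open import Relation.Binary.PropositionalEquality using (_≡_)

data Letter : Set where
  U D H : Letter

Word : Set
Word = List Letter

countL : Letter → Word → ℕ
countL x [] = 0
countL U (U ∷ ys) = suc (countL U ys)
countL D (D ∷ ys) = suc (countL D ys)
countL H (H ∷ ys) = suc (countL H ys)
countL x (_ ∷ ys) = countL x ys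

HasCounts : ℕ → ℕ → Word → Set
HasCounts n d w = (countL U w ≡ n) × (countL D w ≡ n) × (countL H w ≡ d)

Schroder : ℕ → ℕ → Word → Set
Schroder n d w = HasCounts n d w ×
  ((k : ℕ) → countL D (take k w) ≤ countL U (take k w))

Point : Set
Point = ℤ × ℤ

data Step : Set where
  stS stW stN stE stNW stSE : Step

vec : Step → Point
vec stS  = (+ 0 , - (+ 1))
vec stW  = (- (+ 1) , + 0)
vec stN  = (+ 0 , + 1)
vec stE  = (+ 1 , + 0)
vec stNW = (- (+ 1) , + 1)
vec stSE = (+ 1 , - (+ 1))

_⊕_ : Point → Point → Point
(a , b) ⊕ (c , d) = (a + c , b + d)

dbl : Point → Point
dbl (a , b) = (a + a , b + b)

record LPath : Set where
  constructor lpath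
  field
    start : Point
    steps : List Step
open LPath public

endFrom : Point → List Step → Point
endFrom p [] = p
endFrom p (x ∷ xs) = endFrom (p ⊕ vec x) xs

endpoint : LPath → Point
endpoint P = endFrom (start P) (steps P)

-- The point set of a path, encoded on the half-integer grid (coordinates
-- doubled): every vertex v contributes 2v, and every step from v by δ
-- contributes its midpoint 2v+δ and its end 2v+2δ.  For unit steps in the
-- six directions above, two segments meet only at lattice points or overlap
-- in a whole segment, so this faithfully records the point set.
halfPtsFrom : Point → List Step → List Point
halfPtsFrom p [] = []
halfPtsFrom p (x ∷ xs) = (dbl p ⊕ vec x) ∷ dbl (p ⊕ vec x) ∷ halfPtsFrom (p ⊕ vec x) xs

halfPts : LPath → List Point
halfPts P = dbl (start P) ∷ halfPtsFrom (start P) (steps P)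

SamePointSet : LPath → LPath → Set
SamePointSet P Q = (x : Point) → (x ∈ halfPts P → x ∈ halfPts Q) × (x ∈ halfPts Q → x ∈ halfPts P)

data UpperStep : Step → Set where
  up-n  : UpperStep stN
  up-se : UpperStep stSE

data LowerStep : Step → Set where
  lo-e : LowerStep stE
  lo-n : LowerStep stN

origin : Point
origin = (+ 0 , + 0)

IsPathWith : (Step → Set) → Point → Point → LPath → Set
IsPathWith S a b P = Σ[ ss ∈ List Step ]
  (All S ss × endFrom a ss ≡ b × SamePointSet P (lpath a ss))

Sawtooth : ℕ → ℕ → LPath × LPath → Set
Sawtooth N d (P , Q) =
  IsPathWith UpperStep origin (+ N , + d) P ×
  IsPathWith LowerStep origin (+ N , + d) Q ×
  ((x : Point) → x ∈ halfPts P → x ∈ halfPts Q →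
     (x ≡ dbl origin) ⊎ (x ≡ dbl (+ N , + d)))

upperStep : Letter → Step
upperStep U = stNW
upperStep _ = stS

lowerSteps : Letter → List Step
lowerSteps U = []
lowerSteps D = [ stW ]
lowerSteps H = [ stS ]

Upper : ℕ → ℕ → Word → LPath
Upper n d w = lpath (+ suc n , + d) (stNW ∷ map upperStep w ++ [ stS ])

-- final step joins (1,0) to (0,0): a w step
Lower : ℕ → ℕ → Word → LPath
Lower n d w = lpath (+ suc n , + d) (concatMap lowerSteps w ++ [ stW ])

sts : ℕ → ℕ → Word → LPath × LPath
sts n d w = (Upper n d w , Lower n d w)

-- Reading w, the upper path passes through (n − #U p, d + 1 + #U p − #D p − #H p) after the
-- prefix p and the lower path through (n + 1 − #D p, d − #H p); both end at the origin. On the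
-- doubled grid the midpoints of nw and w steps have parities of their own, so a common point of
-- the paths is a common vertex or the midpoint of a common s step, and hence comes from prefixes
-- p, q with #D q = #U p + 1 and #D q + #H q = #D p + #H p. As one of p, q extends the other,
-- #D q ≤ #D p, so #D p > #U p, against the ballot condition. Conversely, the shortest prefix p
-- with #D p > #U p has #D p = #U p + 1, and then both paths pass through the same vertex after p,
-- which is not an endpoint.
module Submission where

open import Defs
open import Data.Nat using (ℕ; _≤_; suc)
open import Data.Product using (_×_)

open import Data.Bool using (Bool; true; false)
open import Data.Empty using (⊥-elim)
open import Data.Integer using (ℤ; +_; -[1+_]; 0ℤ; 1ℤ; -1ℤ; _+_; _-_; -_)
import Data.Integer.Properties as ℤ
open import Data.Integer.Tactic.RingSolver using (solve-∀)
import Data.Nat as ℕ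
import Data.Nat.Properties as ℕ
open import Data.List using (List; []; _∷_; _++_; [_]; map; concatMap; take; drop; length; reverse; _∷ʳ_)
open import Data.List.Properties
  using (map-++; concatMap-++; ++-assoc; ++-identityʳ; unfold-reverse; reverse-++; take++drop≡id; ∷-injective)
open import Data.List.Relation.Unary.All as All using (All; []; _∷_)
import Data.List.Relation.Unary.All.Properties as All
open import Data.List.Relation.Unary.Any using (here; there)
import Data.List.Relation.Unary.Any.Properties as Any
open import Data.List.Membership.Propositional using (_∈_)
open import Data.List.Membership.Propositional.Properties using (∈-++⁻)
open import Data.Product using (_,_; proj₁; proj₂; ∃-syntax)
open import Data.Sum using (_⊎_; inj₁; inj₂)
import Data.Sum as Sum
open import Function using (_∘_)
open import Relation.Binary.PropositionalEquality hiding ([_])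
open import Relation.Nullary using (¬_; yes; no)

-- Integers and the doubled grid

i-j≡i-k⇒j≡k : ∀ i j k → i - j ≡ i - k → j ≡ k
i-j≡i-k⇒j≡k i j k eq = ℤ.neg-injective (begin
  - j          ≡⟨ -j≡[i-j]-i i j ⟩
  (i - j) - i  ≡⟨ cong (_- i) eq ⟩
  (i - k) - i  ≡⟨ -j≡[i-j]-i i k ⟨
  - k          ∎)
  where
  open ≡-Reasoning
  -j≡[i-j]-i : ∀ i j → - j ≡ (i - j) - i
  -j≡[i-j]-i = solve-∀

[1+i]-[1+j]≡i-j : ∀ i j → (1ℤ + i) - (1ℤ + j) ≡ i - j
[1+i]-[1+j]≡i-j = solve-∀

[i-1]-j≡i-[1+j] : ∀ i j → (i - 1ℤ) - j ≡ i - (1ℤ + j)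
[i-1]-j≡i-[1+j] = solve-∀

[i+0]-j≡i-j : ∀ i j → (i + 0ℤ) - j ≡ i - j
[i+0]-j≡i-j i j = cong (_- j) (ℤ.+-identityʳ i)

k+k≡0⇒k≡0 : ∀ k → k + k ≡ 0ℤ → k ≡ 0ℤ
k+k≡0⇒k≡0 (+ 0)     _  = refl
k+k≡0⇒k≡0 (+ suc _) ()
k+k≡0⇒k≡0 -[1+ _ ]  ()

k+k≢1 : ∀ k → k + k ≢ 1ℤ
k+k≢1 (+ 0)           ()
k+k≢1 (+ 1)           ()
k+k≢1 (+ suc (suc _)) ()
k+k≢1 -[1+ _ ]        ()

k+k≢-1 : ∀ k → k + k ≢ -1ℤ
k+k≢-1 (+ _)    ()
k+k≢-1 -[1+ _ ] ()

bit : Bool → ℤ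
bit false = 0ℤ
bit true  = 1ℤ

twice-minus-bit-injective : ∀ a b i j → a + a - bit i ≡ b + b - bit j → a ≡ b × i ≡ j
twice-minus-bit-injective a b i j eq = halve i j (begin
  (a - b) + (a - b)                                      ≡⟨ regroup a b (bit i) (bit j) ⟩
  ((a + a - bit i) - (b + b - bit j)) + (bit i - bit j)  ≡⟨ cong (λ c → (c - b′) + (bit i - bit j)) eq ⟩
  (b′ - b′) + (bit i - bit j)                            ≡⟨ cong (_+ (bit i - bit j)) (ℤ.+-inverseʳ b′) ⟩
  0ℤ + (bit i - bit j)                                   ≡⟨ ℤ.+-identityˡ (bit i - bit j) ⟩
  bit i - bit j                                          ∎)
  where
  open ≡-Reasoning
  b′ : ℤ
  b′ = b + b - bit j
  regroup : ∀ a b x y → (a - b) + (a - b) ≡ ((a + a - x) - (b + b - y)) + (x - y)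
  regroup = solve-∀
  halve : ∀ i j → (a - b) + (a - b) ≡ bit i - bit j → a ≡ b × i ≡ j
  halve false false e = ℤ.i-j≡0⇒i≡j a b (k+k≡0⇒k≡0 (a - b) e) , refl
  halve true  true  e = ℤ.i-j≡0⇒i≡j a b (k+k≡0⇒k≡0 (a - b) e) , refl
  halve true  false e = ⊥-elim (k+k≢1 (a - b) e)
  halve false true  e = ⊥-elim (k+k≢-1 (a - b) e)

-- Every point of the doubled grid is  corner v i j  for exactly one lattice point v and bits i, j:
-- the vertex v itself, or the midpoint of the w, s or sw step leaving v.
corner : Point → Bool → Bool → Point
corner (a , b) i j = (a + a - bit i , b + b - bit j)

corner-injective : ∀ v v' i i' j j' → corner v i j ≡ corner v' i' j' → v ≡ v' × i ≡ i' × j ≡ j'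
corner-injective (a , b) (a' , b') i i' j j' eq
  with twice-minus-bit-injective a a' i i' (cong proj₁ eq)
     | twice-minus-bit-injective b b' j j' (cong proj₂ eq)
... | refl , refl | refl , refl = refl , refl , refl

dbl≡corner : ∀ v → dbl v ≡ corner v false false
dbl≡corner (a , b) = sym (cong₂ _,_ (ℤ.+-identityʳ (a + a)) (ℤ.+-identityʳ (b + b)))

dbl-injective : ∀ v v' → dbl v ≡ dbl v' → v ≡ v'
dbl-injective v v' eq = proj₁ (corner-injective v v' false false false false
  (trans (sym (dbl≡corner v)) (trans eq (dbl≡corner v'))))

nw-midpoint≡corner : ∀ v → dbl v ⊕ vec stNW ≡ corner (v ⊕ vec stN) true true
nw-midpoint≡corner (a , b) = cong₂ _,_ (x a) (y b)
  where
  x : ∀ a → a + a - 1ℤ ≡ (a + 0ℤ) + (a + 0ℤ) - 1ℤ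
  x = solve-∀
  y : ∀ b → b + b + 1ℤ ≡ (b + 1ℤ) + (b + 1ℤ) - 1ℤ
  y = solve-∀

-- Lattice paths and their reversal

endFrom-++ : ∀ a ss ts → endFrom a (ss ++ ts) ≡ endFrom (endFrom a ss) ts
endFrom-++ a []       ts = refl
endFrom-++ a (s ∷ ss) ts = endFrom-++ (a ⊕ vec s) ss ts

halfPtsFrom-++ : ∀ a ss ts → halfPtsFrom a (ss ++ ts) ≡ halfPtsFrom a ss ++ halfPtsFrom (endFrom a ss) ts
halfPtsFrom-++ a []       ts = refl
halfPtsFrom-++ a (s ∷ ss) ts =
  cong (λ xs → (dbl a ⊕ vec s) ∷ dbl (a ⊕ vec s) ∷ xs) (halfPtsFrom-++ (a ⊕ vec s) ss ts)

∈-halfPts-++⁻ : ∀ a ss ts {x} → x ∈ halfPts (lpath a (ss ++ ts)) →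
  x ∈ halfPts (lpath a ss) ⊎ x ∈ halfPtsFrom (endFrom a ss) ts
∈-halfPts-++⁻ a ss ts {x} x∈ =
  ∈-++⁻ (halfPts (lpath a ss)) (subst (x ∈_) (cong (dbl a ∷_) (halfPtsFrom-++ a ss ts)) x∈)

vertex∈halfPts : ∀ a ss ts → dbl (endFrom a ss) ∈ halfPts (lpath a (ss ++ ts))
vertex∈halfPts a []       ts = here refl
vertex∈halfPts a (s ∷ ss) ts = there (there (vertex∈halfPts (a ⊕ vec s) ss ts))

inv : Step → Step
inv stS  = stN
inv stW  = stE
inv stN  = stS
inv stE  = stW
inv stNW = stSE
inv stSE = stNW

vec-inv : ∀ s → vec (inv s) ≡ (- proj₁ (vec s) , - proj₂ (vec s))
vec-inv stS  = refl
vec-inv stW  = refl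
vec-inv stN  = refl
vec-inv stE  = refl
vec-inv stNW = refl
vec-inv stSE = refl

⊕-vec-inv : ∀ v s → (v ⊕ vec s) ⊕ vec (inv s) ≡ v
⊕-vec-inv (a , b) s rewrite vec-inv s = cong₂ _,_ (cancel a _) (cancel b _)
  where
  cancel : ∀ a i → (a + i) - i ≡ a
  cancel = solve-∀

dbl-⊕-vec-inv : ∀ v s → dbl (v ⊕ vec s) ⊕ vec (inv s) ≡ dbl v ⊕ vec s
dbl-⊕-vec-inv (a , b) s rewrite vec-inv s = cong₂ _,_ (halve a _) (halve b _)
  where
  halve : ∀ a i → ((a + i) + (a + i)) - i ≡ (a + a) + i
  halve = solve-∀

reverseSteps : List Step → List Step
reverseSteps ss = reverse (map inv ss)

endFrom-reverseSteps : ∀ a ss → endFrom (endFrom a ss) (reverseSteps ss) ≡ a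
endFrom-reverseSteps a []       = refl
endFrom-reverseSteps a (s ∷ ss) = begin
  endFrom b (reverseSteps (s ∷ ss))          ≡⟨ cong (endFrom b) (unfold-reverse (inv s) (map inv ss)) ⟩
  endFrom b (reverseSteps ss ∷ʳ inv s)       ≡⟨ endFrom-++ b (reverseSteps ss) [ inv s ] ⟩
  endFrom b (reverseSteps ss) ⊕ vec (inv s)  ≡⟨ cong (_⊕ vec (inv s)) (endFrom-reverseSteps (a ⊕ vec s) ss) ⟩
  (a ⊕ vec s) ⊕ vec (inv s)                  ≡⟨ ⊕-vec-inv a s ⟩
  a                                          ∎
  where
  open ≡-Reasoning
  b : Point
  b = endFrom (a ⊕ vec s) ss

halfPts-reverseSteps : ∀ a ss → halfPts (lpath (endFrom a ss) (reverseSteps ss)) ≡ reverse (halfPts (lpath a ss))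
halfPts-reverseSteps a []       = refl
halfPts-reverseSteps a (s ∷ ss) = begin
  dbl b ∷ halfPtsFrom b (reverseSteps (s ∷ ss))
    ≡⟨ cong (λ ts → dbl b ∷ halfPtsFrom b ts) (unfold-reverse (inv s) (map inv ss)) ⟩
  dbl b ∷ halfPtsFrom b (reverseSteps ss ∷ʳ inv s)
    ≡⟨ cong (dbl b ∷_) (halfPtsFrom-++ b (reverseSteps ss) [ inv s ]) ⟩
  halfPts (lpath b (reverseSteps ss)) ++ halfPtsFrom (endFrom b (reverseSteps ss)) [ inv s ]
    ≡⟨ cong₂ (λ xs c → xs ++ halfPtsFrom c [ inv s ])
             (halfPts-reverseSteps (a ⊕ vec s) ss) (endFrom-reverseSteps (a ⊕ vec s) ss) ⟩
  reverse (halfPts (lpath (a ⊕ vec s) ss)) ++ halfPtsFrom (a ⊕ vec s) [ inv s ]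
    ≡⟨ cong (reverse (halfPts (lpath (a ⊕ vec s) ss)) ++_)
            (cong₂ (λ x y → x ∷ y ∷ []) (dbl-⊕-vec-inv a s) (cong dbl (⊕-vec-inv a s))) ⟩
  reverse (halfPts (lpath (a ⊕ vec s) ss)) ++ (dbl a ⊕ vec s) ∷ dbl a ∷ []
    ≡⟨ reverse-++ (dbl a ∷ (dbl a ⊕ vec s) ∷ []) (halfPts (lpath (a ⊕ vec s) ss)) ⟨
  reverse (halfPts (lpath a (s ∷ ss)))
    ∎
  where
  open ≡-Reasoning
  b : Point
  b = endFrom (a ⊕ vec s) ss

reverse-IsPathWith : ∀ (S : Step → Set) a b ss → endFrom a ss ≡ b → All (S ∘ inv) ss →
  IsPathWith S b a (lpath a ss)
reverse-IsPathWith S a _ ss refl S-inv =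
  reverseSteps ss , All-reverse (All.map⁺ S-inv) , endFrom-reverseSteps a ss , samePoints
  where
  All-reverse : ∀ {xs} → All S xs → All S (reverse xs)
  All-reverse Sxs = All.tabulate (All.lookup Sxs ∘ Any.reverse⁻)
  samePoints : SamePointSet (lpath a ss) (lpath (endFrom a ss) (reverseSteps ss))
  samePoints x = (λ x∈ → subst (x ∈_) (sym (halfPts-reverseSteps a ss)) (Any.reverse⁺ x∈))
               , (λ x∈ → Any.reverse⁻ (subst (x ∈_) (halfPts-reverseSteps a ss) x∈))

-- Prefixes and the ballot condition

countL-++ : ∀ x p q → countL x (p ++ q) ≡ countL x p ℕ.+ countL x q
countL-++ x []      q = refl
countL-++ U (U ∷ p) q = cong suc (countL-++ U p q)
countL-++ U (D ∷ p) q = countL-++ U p q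
countL-++ U (H ∷ p) q = countL-++ U p q
countL-++ D (U ∷ p) q = countL-++ D p q
countL-++ D (D ∷ p) q = cong suc (countL-++ D p q)
countL-++ D (H ∷ p) q = countL-++ D p q
countL-++ H (U ∷ p) q = countL-++ H p q
countL-++ H (D ∷ p) q = countL-++ H p q
countL-++ H (H ∷ p) q = cong suc (countL-++ H p q)

infix 4 _≼_

_≼_ : Word → Word → Set
p ≼ w = ∃[ s ] p ++ s ≡ w

[]≼ : ∀ w → [] ≼ w
[]≼ w = w , refl

∷-≼ : ∀ {p w} l → p ≼ w → l ∷ p ≼ l ∷ w
∷-≼ l (s , eq) = s , cong (l ∷_) eq

≼-refl : ∀ w → w ≼ w
≼-refl w = [] , ++-identityʳ w

≼-trans : ∀ {p q w} → p ≼ q → q ≼ w → p ≼ w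
≼-trans {p} (s , refl) (s' , refl) = s ++ s' , sym (++-assoc p s s')

≼-total : ∀ {p q w} → p ≼ w → q ≼ w → p ≼ q ⊎ q ≼ p
≼-total {[]}            _ _ = inj₁ ([]≼ _)
≼-total {_ ∷ _} {[]}    _ _ = inj₂ ([]≼ _)
≼-total {l ∷ p} {_ ∷ q} (s , refl) (s' , eq) with ∷-injective eq
... | refl , eq' = Sum.map (∷-≼ l) (∷-≼ l) (≼-total {p} {q} (s , refl) (s' , eq'))

take-≼ : ∀ k w → take k w ≼ w
take-≼ k w = drop k w , take++drop≡id k w

take-length-++ : ∀ (p s : Word) → take (length p) (p ++ s) ≡ p
take-length-++ []      s = refl
take-length-++ (l ∷ p) s = cong (l ∷_) (take-length-++ p s)

countL-mono-≼ : ∀ x {p q} → p ≼ q → countL x p ≤ countL x q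
countL-mono-≼ x {p} (s , refl) =
  subst (countL x p ≤_) (sym (countL-++ x p s)) (ℕ.m≤m+n (countL x p) (countL x s))

Ballot : Word → Set
Ballot w = ∀ k → countL D (take k w) ≤ countL U (take k w)

ballot-≼ : ∀ {p w} → Ballot w → p ≼ w → countL D p ≤ countL U p
ballot-≼ {p} ballot (s , refl) =
  subst (λ q → countL D q ≤ countL U q) (take-length-++ p s) (ballot (length p))

-- #D − #U moves by at most one per letter.
prefix-with-excess : ∀ j p → suc j ℕ.+ countL U p ≤ countL D p →
  ∃[ q ] q ≼ p × countL D q ≡ suc j ℕ.+ countL U q
prefix-with-excess j       []      ()
prefix-with-excess j       (U ∷ p) le
  with prefix-with-excess (suc j) p (subst (_≤ countL D p) (ℕ.+-suc (suc j) (countL U p)) le)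
... | q , q≼p , e = U ∷ q , ∷-≼ U q≼p , trans e (sym (ℕ.+-suc (suc j) (countL U q)))
prefix-with-excess ℕ.zero  (D ∷ p) _  = D ∷ [] , ∷-≼ D ([]≼ p) , refl
prefix-with-excess (suc j) (D ∷ p) (ℕ.s≤s le) with prefix-with-excess j p le
... | q , q≼p , e = D ∷ q , ∷-≼ D q≼p , cong suc e
prefix-with-excess j       (H ∷ p) le with prefix-with-excess j p le
... | q , q≼p , e = H ∷ q , ∷-≼ H q≼p , e

no-excess-one⇒ballot : ∀ w → (∀ {p} → p ≼ w → countL D p ≢ suc (countL U p)) → Ballot w
no-excess-one⇒ballot w no-excess k with countL D (take k w) ℕ.≤? countL U (take k w)
... | yes le = le
... | no  nle with prefix-with-excess 0 (take k w) (ℕ.≰⇒> nle)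
...   | q , q≼ , e = ⊥-elim (no-excess (≼-trans q≼ (take-≼ k w)) e)

-- Vertices of the two paths

upperTrace lowerTrace : Point → Word → Point
upperTrace a p = endFrom a (map upperStep p)
lowerTrace a p = endFrom a (concatMap lowerSteps p)

upperTrace-≡ : ∀ a b p →
  upperTrace (a , b) p ≡ (a - + countL U p , b + + countL U p - + countL D p - + countL H p)
upperTrace-≡ a b []      = cong₂ _,_ (sym (ℤ.+-identityʳ a)) (y b)
  where
  y : ∀ b → b ≡ b + 0ℤ - 0ℤ - 0ℤ
  y = solve-∀
upperTrace-≡ a b (U ∷ p) = trans (upperTrace-≡ _ _ p) (cong₂ _,_ ([i-1]-j≡i-[1+j] a _) (y b _ _ _))
  where
  y : ∀ b u e h → (b + 1ℤ) + u - e - h ≡ b + (1ℤ + u) - e - h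
  y = solve-∀
upperTrace-≡ a b (D ∷ p) = trans (upperTrace-≡ _ _ p) (cong₂ _,_ ([i+0]-j≡i-j a _) (y b _ _ _))
  where
  y : ∀ b u e h → (b - 1ℤ) + u - e - h ≡ b + u - (1ℤ + e) - h
  y = solve-∀
upperTrace-≡ a b (H ∷ p) = trans (upperTrace-≡ _ _ p) (cong₂ _,_ ([i+0]-j≡i-j a _) (y b _ _ _))
  where
  y : ∀ b u e h → (b - 1ℤ) + u - e - h ≡ b + u - e - (1ℤ + h)
  y = solve-∀

lowerTrace-≡ : ∀ a b p → lowerTrace (a , b) p ≡ (a - + countL D p , b - + countL H p)
lowerTrace-≡ a b []      = sym (cong₂ _,_ (ℤ.+-identityʳ a) (ℤ.+-identityʳ b))
lowerTrace-≡ a b (U ∷ p) = lowerTrace-≡ a b p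
lowerTrace-≡ a b (D ∷ p) =
  trans (lowerTrace-≡ _ _ p) (cong₂ _,_ ([i-1]-j≡i-[1+j] a _) ([i+0]-j≡i-j b _))
lowerTrace-≡ a b (H ∷ p) =
  trans (lowerTrace-≡ _ _ p) (cong₂ _,_ ([i+0]-j≡i-j a _) ([i-1]-j≡i-[1+j] b _))

upperVertex lowerVertex : ℕ → ℕ → Word → Point
upperVertex n d = upperTrace ((+ suc n , + d) ⊕ vec stNW)
lowerVertex n d = lowerTrace (+ suc n , + d)

upperVertex-≡ : ∀ n d p {u a h} → countL U p ≡ u → countL D p ≡ a → countL H p ≡ h →
  upperVertex n d p ≡ (+ n - + u , + suc d + + u - + a - + h)
upperVertex-≡ n d p {u} {a} {h} refl refl refl =
  trans (upperTrace-≡ _ _ p) (cong₂ _,_ (x (+ n) (+ u)) (y (+ d) (+ u) (+ a) (+ h)))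
  where
  x : ∀ n u → ((1ℤ + n) - 1ℤ) - u ≡ n - u
  x = solve-∀
  y : ∀ d u a h → (d + 1ℤ) + u - a - h ≡ (1ℤ + d) + u - a - h
  y = solve-∀

lowerVertex-≡ : ∀ n d p {a h} → countL D p ≡ a → countL H p ≡ h →
  lowerVertex n d p ≡ (+ suc n - + a , + d - + h)
lowerVertex-≡ n d p refl refl = lowerTrace-≡ _ _ p

upperVertex≡lowerVertex⇒ : ∀ n d p q → upperVertex n d p ≡ lowerVertex n d q →
  countL D q ≡ suc (countL U p) × countL D q ℕ.+ countL H q ≡ countL D p ℕ.+ countL H p
upperVertex≡lowerVertex⇒ n d p q eq =
  sym (ℤ.+-injective (i-j≡i-k⇒j≡k (+ suc n) _ _ x-eq)) ,
  ℤ.+-injective (i-j≡i-k⇒j≡k (+ (suc n ℕ.+ d)) _ _ x+y-eq)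
  where
  u a h a' h' : ℕ
  u = countL U p ; a = countL D p ; h = countL H p ; a' = countL D q ; h' = countL H q
  coords : (+ n - + u , + suc d + + u - + a - + h) ≡ (+ suc n - + a' , + d - + h')
  coords = trans (sym (upperVertex-≡ n d p refl refl refl)) (trans eq (lowerVertex-≡ n d q refl refl))
  x-eq : + suc n - + suc u ≡ + suc n - + a'
  x-eq = trans ([1+i]-[1+j]≡i-j (+ n) (+ u)) (cong proj₁ coords)
  upper-sum : ∀ n d u a h → (n - u) + ((1ℤ + d) + u - a - h) ≡ ((1ℤ + n) + d) - (a + h)
  upper-sum = solve-∀
  lower-sum : ∀ n d a h → (n - a) + (d - h) ≡ (n + d) - (a + h)
  lower-sum = solve-∀
  x+y-eq : + (suc n ℕ.+ d) - + (a' ℕ.+ h') ≡ + (suc n ℕ.+ d) - + (a ℕ.+ h)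
  x+y-eq = begin
    + (suc n ℕ.+ d) - + (a' ℕ.+ h')            ≡⟨ lower-sum (+ suc n) (+ d) (+ a') (+ h') ⟨
    (+ suc n - + a') + (+ d - + h')            ≡⟨ cong (λ v → proj₁ v + proj₂ v) coords ⟨
    (+ n - + u) + (+ suc d + + u - + a - + h)  ≡⟨ upper-sum (+ n) (+ d) (+ u) (+ a) (+ h) ⟩
    + (suc n ℕ.+ d) - + (a ℕ.+ h)              ∎
    where open ≡-Reasoning

excess⇒upperVertex≡lowerVertex : ∀ n d p → countL D p ≡ suc (countL U p) →
  upperVertex n d p ≡ lowerVertex n d p
excess⇒upperVertex≡lowerVertex n d p e = begin
  upperVertex n d p                            ≡⟨ upperVertex-≡ n d p refl e refl ⟩
  (+ n - + u , + suc d + + u - + suc u - + h)  ≡⟨ cong₂ _,_ ([1+i]-[1+j]≡i-j (+ n) (+ u)) (y (+ d) (+ u) (+ h)) ⟨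
  (+ suc n - + suc u , + d - + h)              ≡⟨ lowerVertex-≡ n d p e refl ⟨
  lowerVertex n d p                            ∎
  where
  open ≡-Reasoning
  u h : ℕ
  u = countL U p ; h = countL H p
  y : ∀ d u h → d - h ≡ (1ℤ + d) + u - (1ℤ + u) - h
  y = solve-∀

upperVertex-last : ∀ n d w → HasCounts n d w → upperVertex n d w ⊕ vec stS ≡ origin
upperVertex-last n d w (#U , #D , #H) =
  trans (cong (_⊕ vec stS) (upperVertex-≡ n d w #U #D #H)) (cong₂ _,_ (x (+ n)) (y (+ n) (+ d)))
  where
  x : ∀ n → n - n + 0ℤ ≡ 0ℤ
  x = solve-∀
  y : ∀ n d → (1ℤ + d) + n - n - d - 1ℤ ≡ 0ℤ
  y = solve-∀

lowerVertex-last : ∀ n d w → HasCounts n d w → lowerVertex n d w ⊕ vec stW ≡ origin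
lowerVertex-last n d w (_ , #D , #H) =
  trans (cong (_⊕ vec stW) (lowerVertex-≡ n d w #D #H)) (cong₂ _,_ (x (+ n)) (y (+ d)))
  where
  x : ∀ n → (1ℤ + n) - n - 1ℤ ≡ 0ℤ
  x = solve-∀
  y : ∀ d → d - d + 0ℤ ≡ 0ℤ
  y = solve-∀

upperVertex∈Upper : ∀ n d {p w} → p ≼ w → dbl (upperVertex n d p) ∈ halfPts (Upper n d w)
upperVertex∈Upper n d {p} (s , refl) =
  subst (λ ss → dbl (upperVertex n d p) ∈ halfPts (lpath (+ suc n , + d) (stNW ∷ ss)))
        (trans (sym (++-assoc (map upperStep p) (map upperStep s) [ stS ]))
               (cong (_++ [ stS ]) (sym (map-++ upperStep p s))))
        (vertex∈halfPts (+ suc n , + d) (stNW ∷ map upperStep p) (map upperStep s ++ [ stS ]))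

lowerVertex∈Lower : ∀ n d {p w} → p ≼ w → dbl (lowerVertex n d p) ∈ halfPts (Lower n d w)
lowerVertex∈Lower n d {p} (s , refl) =
  subst (λ ss → dbl (lowerVertex n d p) ∈ halfPts (lpath (+ suc n , + d) ss))
        (trans (sym (++-assoc (concatMap lowerSteps p) (concatMap lowerSteps s) [ stW ]))
               (cong (_++ [ stW ]) (sym (concatMap-++ lowerSteps p s))))
        (vertex∈halfPts (+ suc n , + d) (concatMap lowerSteps p) (concatMap lowerSteps s ++ [ stW ]))

-- The two paths

Upper-isPath : ∀ n d w → HasCounts n d w → IsPathWith UpperStep origin (+ suc n , + d) (Upper n d w)
Upper-isPath n d w hc = reverse-IsPathWith UpperStep _ origin (steps (Upper n d w))
  (trans (endFrom-++ (+ suc n , + d) (stNW ∷ map upperStep w) [ stS ]) (upperVertex-last n d w hc))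
  (up-se ∷ All.++⁺ (All.map⁺ (All.universal upperStep-inv w)) (up-n ∷ []))
  where
  upperStep-inv : ∀ l → UpperStep (inv (upperStep l))
  upperStep-inv U = up-se
  upperStep-inv D = up-n
  upperStep-inv H = up-n

Lower-isPath : ∀ n d w → HasCounts n d w → IsPathWith LowerStep origin (+ suc n , + d) (Lower n d w)
Lower-isPath n d w hc = reverse-IsPathWith LowerStep _ origin (steps (Lower n d w))
  (trans (endFrom-++ (+ suc n , + d) (concatMap lowerSteps w) [ stW ]) (lowerVertex-last n d w hc))
  (All.++⁺ (All.concat⁺ (All.map⁺ (All.universal lowerSteps-inv w))) (lo-e ∷ []))
  where
  lowerSteps-inv : ∀ l → All (LowerStep ∘ inv) (lowerSteps l)
  lowerSteps-inv U = []
  lowerSteps-inv D = lo-e ∷ []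
  lowerSteps-inv H = lo-n ∷ []

AtOrBelowVertex : (Word → Point) → Word → Point → Set
AtOrBelowVertex vertex w x = ∃[ p ] ∃[ j ] p ≼ w × x ≡ corner (vertex p) false j

AtOrBelowVertex-∷ : ∀ vertex {w x} l → AtOrBelowVertex (vertex ∘ (l ∷_)) w x → AtOrBelowVertex vertex (l ∷ w) x
AtOrBelowVertex-∷ _ l (p , j , p≼w , eq) = l ∷ p , j , ∷-≼ l p≼w , eq

upperSteps-points : ∀ a w {x} → x ∈ halfPts (lpath a (map upperStep w)) →
  (∃[ v ] x ≡ corner v true true) ⊎ AtOrBelowVertex (upperTrace a) w x
upperSteps-points a w       (here refl)         = inj₂ ([] , false , []≼ w , dbl≡corner a)
upperSteps-points a []      (there ())
upperSteps-points a (U ∷ w) (there (here refl)) = inj₁ (a ⊕ vec stN , nw-midpoint≡corner a)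
upperSteps-points a (D ∷ w) (there (here refl)) = inj₂ ([] , true , []≼ (D ∷ w) , refl)
upperSteps-points a (H ∷ w) (there (here refl)) = inj₂ ([] , true , []≼ (H ∷ w) , refl)
upperSteps-points a (l ∷ w) (there (there x∈))  =
  Sum.map₂ (AtOrBelowVertex-∷ (upperTrace a) l) (upperSteps-points (a ⊕ vec (upperStep l)) w x∈)

lowerSteps-points : ∀ a w {x} → x ∈ halfPts (lpath a (concatMap lowerSteps w)) →
  (∃[ v ] x ≡ corner v true false) ⊎ AtOrBelowVertex (lowerTrace a) w x
lowerSteps-points a (U ∷ w) x∈ =
  Sum.map₂ (AtOrBelowVertex-∷ (lowerTrace a) U) (lowerSteps-points a w x∈)
lowerSteps-points a w       (here refl)         = inj₂ ([] , false , []≼ w , dbl≡corner a)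
lowerSteps-points a []      (there ())
lowerSteps-points a (D ∷ w) (there (here refl)) = inj₁ (a , refl)
lowerSteps-points a (H ∷ w) (there (here refl)) = inj₂ ([] , true , []≼ (H ∷ w) , refl)
lowerSteps-points a (D ∷ w) (there (there x∈))  =
  Sum.map₂ (AtOrBelowVertex-∷ (lowerTrace a) D) (lowerSteps-points (a ⊕ vec stW) w x∈)
lowerSteps-points a (H ∷ w) (there (there x∈))  =
  Sum.map₂ (AtOrBelowVertex-∷ (lowerTrace a) H) (lowerSteps-points (a ⊕ vec stS) w x∈)

Endpoint : ℕ → ℕ → Point → Set
Endpoint n d x = (x ≡ dbl origin) ⊎ (x ≡ dbl (+ suc n , + d))

Upper-points : ∀ n d w {x} → HasCounts n d w → x ∈ halfPts (Upper n d w) →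
  Endpoint n d x ⊎ (∃[ v ] x ≡ corner v true true) ⊎ AtOrBelowVertex (upperVertex n d) w x
Upper-points n d w hc (here refl)         = inj₁ (inj₂ refl)
Upper-points n d w hc (there (here refl)) =
  inj₂ (inj₁ ((+ suc n , + d) ⊕ vec stN , nw-midpoint≡corner (+ suc n , + d)))
Upper-points n d w hc (there (there x∈))
  with ∈-halfPts-++⁻ ((+ suc n , + d) ⊕ vec stNW) (map upperStep w) [ stS ] x∈
... | inj₁ x∈w                 = inj₂ (upperSteps-points _ w x∈w)
... | inj₂ (here refl)         = inj₂ (inj₂ (w , true , ≼-refl w , refl))
... | inj₂ (there (here refl)) = inj₁ (inj₁ (cong dbl (upperVertex-last n d w hc)))

Lower-points : ∀ n d w {x} → HasCounts n d w → x ∈ halfPts (Lower n d w) →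
  Endpoint n d x ⊎ (∃[ v ] x ≡ corner v true false) ⊎ AtOrBelowVertex (lowerVertex n d) w x
Lower-points n d w hc x∈ with ∈-halfPts-++⁻ (+ suc n , + d) (concatMap lowerSteps w) [ stW ] x∈
... | inj₁ x∈w                 = inj₂ (lowerSteps-points _ w x∈w)
... | inj₂ (here refl)         = inj₂ (inj₁ (lowerVertex n d w , refl))
... | inj₂ (there (here refl)) = inj₁ (inj₁ (cong dbl (lowerVertex-last n d w hc)))

common-vertex : ∀ {upper lower : Word → Point} {w x} →
  (∃[ v ] x ≡ corner v true true) ⊎ AtOrBelowVertex upper w x →
  (∃[ v ] x ≡ corner v true false) ⊎ AtOrBelowVertex lower w x →
  ∃[ p ] ∃[ q ] p ≼ w × q ≼ w × upper p ≡ lower q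
common-vertex (inj₁ (v , refl)) (inj₁ (v' , eq)) with corner-injective v v' true true true false eq
... | _ , _ , ()
common-vertex {lower = lower} (inj₁ (v , refl)) (inj₂ (q , j , _ , eq))
  with corner-injective v (lower q) true false true j eq
... | _ , () , _
common-vertex {upper = upper} (inj₂ (p , j , _ , refl)) (inj₁ (v' , eq))
  with corner-injective (upper p) v' false true j false eq
... | _ , () , _
common-vertex {upper = upper} {lower} (inj₂ (p , j , p≼w , refl)) (inj₂ (q , j' , q≼w , eq)) =
  p , q , p≼w , q≼w , proj₁ (corner-injective (upper p) (lower q) false false j j' eq)

lowerVertex-not-endpoint : ∀ n d p → 0 ℕ.< countL D p → countL D p ≤ n →
  ¬ Endpoint n d (dbl (lowerVertex n d p))
lowerVertex-not-endpoint n d p 0<a a≤n (inj₁ eq) = ℕ.1+n≰n (subst (_≤ n) (sym n+1≡a) a≤n)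
  where
  n+1≡a : suc n ≡ countL D p
  n+1≡a = ℤ.+-injective (ℤ.i-j≡0⇒i≡j _ _
    (cong proj₁ (trans (sym (lowerVertex-≡ n d p refl refl)) (dbl-injective _ origin eq))))
lowerVertex-not-endpoint n d p 0<a a≤n (inj₂ eq) = ℕ.n≮n 0 (subst (0 ℕ.<_) a≡0 0<a)
  where
  x-eq : + suc n - + countL D p ≡ + suc n - + 0
  x-eq = trans (cong proj₁ (trans (sym (lowerVertex-≡ n d p refl refl)) (dbl-injective _ (+ suc n , + d) eq)))
               (sym (ℤ.+-identityʳ (+ suc n)))
  a≡0 : countL D p ≡ 0
  a≡0 = ℤ.+-injective (i-j≡i-k⇒j≡k (+ suc n) _ _ x-eq)

upperVertex≢lowerVertex : ∀ n d {w p q} → Ballot w → p ≼ w → q ≼ w → upperVertex n d p ≢ lowerVertex n d q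
upperVertex≢lowerVertex n d {p = p} {q} ballot p≼w q≼w eq
  with upperVertex≡lowerVertex⇒ n d p q eq
... | #Dq≡1+#Up , #D+#Hq≡#D+#Hp =
  ℕ.<⇒≱ (subst (_≤ countL D p) #Dq≡1+#Up #Dq≤#Dp) (ballot-≼ ballot p≼w)
  where
  #Dq≤#Dp : countL D q ≤ countL D p
  #Dq≤#Dp with ≼-total p≼w q≼w
  ... | inj₁ p≼q = ℕ.+-cancelʳ-≤ (countL H p) (countL D q) (countL D p)
                     (ℕ.≤-trans (ℕ.+-monoʳ-≤ (countL D q) (countL-mono-≼ H p≼q)) (ℕ.≤-reflexive #D+#Hq≡#D+#Hp))
  ... | inj₂ q≼p = countL-mono-≼ D q≼p

MeetOnlyAtEndpoints : ℕ → ℕ → Word → Set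
MeetOnlyAtEndpoints n d w = ∀ x → x ∈ halfPts (Upper n d w) → x ∈ halfPts (Lower n d w) → Endpoint n d x

ballot⇒meetOnlyAtEndpoints : ∀ n d w → HasCounts n d w → Ballot w → MeetOnlyAtEndpoints n d w
ballot⇒meetOnlyAtEndpoints n d w hc ballot x x∈U x∈L
  with Upper-points n d w hc x∈U | Lower-points n d w hc x∈L
... | inj₁ end | _        = end
... | inj₂ _   | inj₁ end = end
... | inj₂ up  | inj₂ lo with common-vertex up lo
...   | p , q , p≼w , q≼w , eq = ⊥-elim (upperVertex≢lowerVertex n d ballot p≼w q≼w eq)

meetOnlyAtEndpoints⇒ballot : ∀ n d w → HasCounts n d w → MeetOnlyAtEndpoints n d w → Ballot w
meetOnlyAtEndpoints⇒ballot n d w (_ , #D , _) meet = no-excess-one⇒ballot w no-excess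
  where
  no-excess : ∀ {p} → p ≼ w → countL D p ≢ suc (countL U p)
  no-excess {p} p≼w e = lowerVertex-not-endpoint n d p
    (subst (0 ℕ.<_) (sym e) ℕ.z<s) (subst (countL D p ≤_) #D (countL-mono-≼ D p≼w))
    (meet _ (subst (λ v → dbl v ∈ halfPts (Upper n d w)) (excess⇒upperVertex≡lowerVertex n d p e)
                   (upperVertex∈Upper n d p≼w))
            (lowerVertex∈Lower n d p≼w))

theorem4p5 : (n d : ℕ) → 1 ≤ n → 1 ≤ d → (w : Word) → HasCounts n d w →
    (Schroder n d w → Sawtooth (suc n) d (sts n d w)) × (Sawtooth (suc n) d (sts n d w) → Schroder n d w)
theorem4p5 n d _ _ w hc =
    (λ (_ , ballot) → Upper-isPath n d w hc , Lower-isPath n d w hc , ballot⇒meetOnlyAtEndpoints n d w hc ballot)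
  , (λ (_ , _ , meet) → hc , meetOnlyAtEndpoints⇒ballot n d w hc meet)
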